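{- The property of Seidel equivalence of a pair of graphs is testable: there exist $q\in\mathbb{N}$ and $\epsilon>0$ such that for every $n$, the set of pairs $(\Gamma,\Gamma')$ of graphs on the vertex set $[n]$ such that $\Gamma'$ is Seidel equivalent to $\Gamma$ is $(q,\epsilon)$-testable, where a pair of graphs on $[n]$ is encoded as an element of $\{0,1\}^{2\binom{n}{2}}$ (the edge indicator vectors of $\Gamma$ and $\Gamma'$).
   Context: For a graph $\Gamma$ on $[n]=\{1,\dots,n\}$ and a vertex $v$, the Seidel switching of $\Gamma$ along $v$ is the graph obtained by deleting all edges of $\Gamma$ incident to $v$ and joining $v$ to every vertex of $[n]\setminus\{v\}$ that was not a neighbor of $v$ in $\Gamma$. A graph $\Gamma'$ on $[n]$ is Seidel equivalent to $\Gamma$ if it can be obtained from $\Gamma$ by a finite sequence of Seidel switchings (vertices keep their labels). For a finite set $A$, $W\subseteq A^N$ and $P\subseteq W$, $P$ is $(q,\epsilon)$-testable if there is a randomized algorithm that, on input $\alpha\in W$, queries only $q$ coordinates of $\alpha$, always answers "yes" if $\alpha\in P$, and answers "no" with probability at least $\epsilon\cdot\overline{dist}(\alpha,P)$, where $\overline{dist}$ is the normalized Hamming distance. -}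

module Defs where

open import Data.Bool using (Bool; true; false; not; if_then_else_; _xor_)
open import Data.Nat using (ℕ; zero; suc; _*_; _≤_; _+_)
open import Data.Nat.Combinatorics using (_C_)
open import Data.Fin using (Fin; _<_)
open import Data.Fin.Properties using (_<?_; _≟_)
open import Data.List using (List; []; _∷_; length; map; filter; allFin)
open import Data.Nat.ListAction using (sum)
open import Data.Product using (Σ; _×_; _,_; ∃)
open import Relation.Binary.PropositionalEquality using (_≡_)
open import Relation.Nullary using (yes; no; ¬_)
open import Relation.Nullary.Decidable using (⌊_⌋)
open import Data.Bool using () renaming (_≟_ to _≟B_)

-- An adaptive deterministic query strategy making at most q queries:
-- a decision tree of depth ≤ q whose inner nodes query a coordinate.
data DT (I : Set) : ℕ → Set where
  leaf  : ∀ {q} → Bool → DT I q                          -- true = "yes"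
  query : ∀ {q} → I → (ifFalse ifTrue : DT I q) → DT I (suc q)

run : ∀ {I q} → DT I q → (I → Bool) → Bool
run (leaf b)        α = b
run (query i t₀ t₁) α = if α i then run t₁ α else run t₀ α

-- A randomized q-query algorithm: the uniform distribution over a nonempty
-- finite list (multiset) of q-query decision trees (random coins).
record RandAlg (I : Set) (q : ℕ) : Set where
  field
    trees    : List (DT I q)
    nonempty : ¬ (trees ≡ [])

rejects : ∀ {I q} → RandAlg I q → (I → Bool) → ℕ
rejects A α = length (filter (λ t → run t α ≟B false) (RandAlg.trees A))

-- Pr[no] ≥ (a/b) · dist(α,P) with dist(α,P) = min_{β∈P} ham(α,β)/N
-- and Pr[no] = rejects / #trees is written out, cross-multiplied, as:
-- there is β ∈ P with  rejects·b·N ≥ a·ham(α,β)·#trees.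
Testable : (I : Set) (N : ℕ) (ham : (I → Bool) → (I → Bool) → ℕ)
           (P : (I → Bool) → Set) (q a b : ℕ) → Set
Testable I N ham P q a b = Σ (RandAlg I q) λ A →
    (∀ α → P α → rejects A α ≡ 0)
  × (∀ α → ∃ λ β → P β ×
       (a * ham α β * length (RandAlg.trees A) ≤ rejects A α * b * N))

Graph : ℕ → Set
Graph n = Fin n → Fin n → Bool

switch : ∀ {n} → Fin n → Graph n → Graph n
switch v G i j = (⌊ i ≟ v ⌋ xor ⌊ j ≟ v ⌋) xor G i j

data SeidelEquiv {n} : Graph n → Graph n → Set where
  done : ∀ {G H} → (∀ i j → G i j ≡ H i j) → SeidelEquiv G H
  step : ∀ {G H} (v : Fin n) → SeidelEquiv (switch v G) H → SeidelEquiv G H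

-- the unordered pairs {i,j}, represented as i < j
Pair : ℕ → Set
Pair n = Σ (Fin n) λ i → Σ (Fin n) λ j → i < j

-- coordinate (false , e) : edge indicator of Γ ; (true , e) : of Γ'
Coord : ℕ → Set
Coord n = Bool × Pair n

graphOf : ∀ {n} → Bool → (Coord n → Bool) → Graph n
graphOf b α i j with i <? j | j <? i
... | yes p | _     = α (b , i , j , p)
... | no _  | yes p = α (b , j , i , p)
... | no _  | no _  = false

diffAt : ∀ {n} → (Coord n → Bool) → (Coord n → Bool) → Bool → Fin n → Fin n → ℕ
diffAt α β b i j with i <? j
... | yes p = if α (b , i , j , p) xor β (b , i , j , p) then 1 else 0
... | no _  = 0

hamming : ∀ {n} → (Coord n → Bool) → (Coord n → Bool) → ℕ
hamming {n} α β =
  sum (map (λ b → sum (map (λ i → sum (map (λ j → diffAt α β b i j)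
     (allFin n))) (allFin n))) (false ∷ true ∷ []))

SeidelPairs : (n : ℕ) → (Coord n → Bool) → Set
SeidelPairs n α = SeidelEquiv (graphOf false α) (graphOf true α)

module Submission where

-- Write Δ G H for the symmetric difference of two graphs on [n].  Switching G
-- along a vertex set S adds to Δ G H the "coboundary" (i,j) ↦ [i∈S] ⊕ [j∈S],
-- whose sum over the three edges of a triangle vanishes; hence if H is Seidel
-- equivalent to G then every triangle has even Δ-sum (seidel-triangle).
-- Conversely, switching along any set is a Seidel equivalence
-- (switchSet-equiv), so for a fixed vertex v, switching Γ along
-- S = {x : Δ Γ Γ′ v x = 1} gives a graph Seidel equivalent to Γ which differs
-- from Γ′ exactly on the pairs {i,j} for which the triangle v i j is odd
-- (module Repair).
--
-- The tester picks a uniformly random ordered triple (v,u,w) (plus one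
-- always-accepting choice, so that the list of coins is never empty), queries
-- the six edge indicators of the triangle in Γ and Γ′, and rejects iff its
-- Δ-sum is odd.  For soundness we
-- repair at a vertex v with at most the average number of odd triangles, so
-- the distance is at most (#odd triples)/n, and a short computation
-- (soundness-arithmetic) gives the required inequality with ε = 1/3.

open import Defs
open import Data.Nat using (ℕ; _>_; _*_; zero; suc; _+_; _≤_; z≤n; s≤s; _≤?_)
open import Data.Nat.Properties
  using ( ≤-trans; ≤-reflexive; <⇒≤; ≰⇒>; +-mono-≤; +-monoˡ-≤; +-monoʳ-≤; *-monoˡ-≤; *-monoʳ-≤
        ; +-cancelʳ-≤; *-identityˡ; *-identityʳ; +-identityʳ; *-assoc; m≤n*m; module ≤-Reasoning)
open import Data.Nat.Combinatorics using (_C_; nCk+nC[k+1]≡[n+1]C[k+1]; nC1≡n)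
open import Data.Nat.ListAction using (sum)
open import Data.Nat.ListAction.Properties using (sum-++)
open import Data.Nat.Solver using (module +-*-Solver)
open import Data.Bool using (Bool; true; false; not; _xor_; if_then_else_)
open import Data.Bool using () renaming (_≟_ to _≟B_)
open import Data.Bool.Properties using (xor-same; xor-assoc; xor-comm; not-involutive)
open import Data.Bool.Solver using (module xor-∧-Solver)
open import Data.Fin using (Fin; zero; suc; fromℕ<) renaming (_<_ to _<F_)
open import Data.Fin.Properties using (_<?_; _≟_; <-cmp; <-irrefl; <-irrelevant; <-asym)
open import Data.List using (List; []; _∷_; _++_; length; map; filter; allFin; concatMap)
open import Data.List.Properties using (map-++; map-∘; length-map; length-tabulate)
open import Data.Vec using (Vec; []; _∷_)
import Data.Vec as Vec
open import Data.Product using (∃; _×_; _,_)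
open import Function using (_∘_)
open import Relation.Binary.PropositionalEquality
open import Relation.Binary using (tri<; tri≈; tri>)
open import Relation.Nullary using (yes; no)
open import Relation.Nullary.Decidable using (⌊_⌋)
open import Data.Empty using (⊥-elim)

module _ {n : ℕ} where
  open xor-∧-Solver

  switchSet : (Fin n → Bool) → Graph n → Graph n
  switchSet s G i j = (s i xor s j) xor G i j

  parityOf : List (Fin n) → Fin n → Bool
  parityOf []       k = false
  parityOf (x ∷ xs) k = ⌊ k ≟ x ⌋ xor parityOf xs k

  switch-then-switchSet : ∀ x xs (G : Graph n) i j →
    switchSet (parityOf xs) (switch x G) i j ≡ switchSet (parityOf (x ∷ xs)) G i j
  switch-then-switchSet x xs G i j =
    solve 5 (λ eᵢ eⱼ mᵢ mⱼ g → (mᵢ :+ mⱼ) :+ ((eᵢ :+ eⱼ) :+ g) := ((eᵢ :+ mᵢ) :+ (eⱼ :+ mⱼ)) :+ g)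
      refl ⌊ i ≟ x ⌋ ⌊ j ≟ x ⌋ (parityOf xs i) (parityOf xs j) (G i j)

  switchList-equiv : ∀ xs (G H : Graph n) →
    (∀ i j → switchSet (parityOf xs) G i j ≡ H i j) → SeidelEquiv G H
  switchList-equiv []       G H same = done same
  switchList-equiv (x ∷ xs) G H same =
    step x (switchList-equiv xs (switch x G) H λ i j → trans (switch-then-switchSet x xs G i j) (same i j))

support : ∀ {n} → (Fin n → Bool) → List (Fin n)
support {zero}  s = []
support {suc n} s = if s zero then zero ∷ later else later
  where later = map suc (support (s ∘ suc))

parityOf-suc-zero : ∀ {n} (xs : List (Fin n)) → parityOf (map suc xs) zero ≡ false
parityOf-suc-zero []       = refl
parityOf-suc-zero (x ∷ xs) = parityOf-suc-zero xs

parityOf-suc : ∀ {n} (xs : List (Fin n)) k → parityOf (map suc xs) (suc k) ≡ parityOf xs k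
parityOf-suc []       k = refl
parityOf-suc (x ∷ xs) k = cong₂ _xor_ (suc-equal k x) (parityOf-suc xs k)
  where
  suc-equal : ∀ {n} (k x : Fin n) → ⌊ suc k ≟ suc x ⌋ ≡ ⌊ k ≟ x ⌋
  suc-equal k x with k ≟ x
  ... | yes _ = refl
  ... | no _  = refl

parityOf-support : ∀ {n} (s : Fin n → Bool) k → parityOf (support s) k ≡ s k
parityOf-support {suc n} s zero with s zero
... | true  = cong (true xor_) (parityOf-suc-zero (support (s ∘ suc)))
... | false = parityOf-suc-zero (support (s ∘ suc))
parityOf-support {suc n} s (suc k) with s zero
... | true  = trans (parityOf-suc (support (s ∘ suc)) k) (parityOf-support (s ∘ suc) k)
... | false = trans (parityOf-suc (support (s ∘ suc)) k) (parityOf-support (s ∘ suc) k)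

switchSet-equiv : ∀ {n} (s : Fin n → Bool) (G H : Graph n) →
  (∀ i j → switchSet s G i j ≡ H i j) → SeidelEquiv G H
switchSet-equiv s G H same = switchList-equiv (support s) G H λ i j →
  trans (cong₂ (λ a b → (a xor b) xor G i j) (parityOf-support s i) (parityOf-support s j)) (same i j)

module _ {n : ℕ} where
  open xor-∧-Solver

  Δ : Graph n → Graph n → Graph n
  Δ G H i j = G i j xor H i j

  triangleSum : Graph n → Fin n → Fin n → Fin n → Bool
  triangleSum g v u w = g v u xor (g v w xor g u w)

  triangleSum-cong : ∀ {g h : Graph n} → (∀ i j → g i j ≡ h i j) →
    ∀ v u w → triangleSum g v u w ≡ triangleSum h v u w
  triangleSum-cong same v u w = cong₂ _xor_ (same v u) (cong₂ _xor_ (same v w) (same u w))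

  -- Switching changes no triangle sum: a coboundary sums to zero around a
  -- triangle.
  triangleSum-switchSet : ∀ s g v u w → triangleSum (switchSet s g) v u w ≡ triangleSum g v u w
  triangleSum-switchSet s g v u w =
    solve 6 (λ a b c g₁ g₂ g₃ →
               ((a :+ b) :+ g₁) :+ (((a :+ c) :+ g₂) :+ ((b :+ c) :+ g₃)) := g₁ :+ (g₂ :+ g₃))
      refl (s v) (s u) (s w) (g v u) (g v w) (g u w)

  seidel-triangle : ∀ {G H} → SeidelEquiv G H → ∀ v u w → triangleSum (Δ G H) v u w ≡ false
  seidel-triangle {G} {H} (done same) = triangleSum-cong λ i j →
    trans (cong (_xor H i j) (same i j)) (xor-same (H i j))
  seidel-triangle {G} {H} (step x equiv) v u w = begin
    triangleSum (Δ G H) v u w                           ≡⟨ sym (triangleSum-switchSet isX (Δ G H) v u w) ⟩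
    triangleSum (switchSet isX (Δ G H)) v u w           ≡⟨ triangleSum-cong (λ i j → sym (xor-assoc (isX i xor isX j) (G i j) (H i j))) v u w ⟩
    triangleSum (Δ (switch x G) H) v u w                ≡⟨ seidel-triangle equiv v u w ⟩
    false                                               ∎
    where
    open ≡-Reasoning
    isX : Fin n → Bool
    isX k = ⌊ k ≟ x ⌋

ind : Bool → ℕ
ind b = if b then 1 else 0

module _ {n : ℕ} where

  graphOf-< : ∀ b (α : Coord n → Bool) i j (p : i <F j) → graphOf b α i j ≡ α (b , i , j , p)
  graphOf-< b α i j p with i <? j | j <? i
  ... | yes p′ | _ = cong (λ q → α (b , i , j , q)) (<-irrelevant p′ p)
  ... | no ¬p  | _ = ⊥-elim (¬p p)

  graphOf-> : ∀ b (α : Coord n → Bool) i j (p : j <F i) → graphOf b α i j ≡ α (b , j , i , p)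
  graphOf-> b α i j p with i <? j | j <? i
  ... | yes p′ | _      = ⊥-elim (<-asym p p′)
  ... | no _   | yes p′ = cong (λ q → α (b , j , i , q)) (<-irrelevant p′ p)
  ... | no _   | no ¬p  = ⊥-elim (¬p p)

  graphOf-loopless : ∀ b (α : Coord n → Bool) i → graphOf b α i i ≡ false
  graphOf-loopless b α i with i <? i
  ... | yes p = ⊥-elim (<-irrefl refl p)
  ... | no _  = refl

  graphOf-sym : ∀ b (α : Coord n → Bool) i j → graphOf b α i j ≡ graphOf b α j i
  graphOf-sym b α i j with <-cmp i j
  ... | tri< p _ _    = trans (graphOf-< b α i j p) (sym (graphOf-> b α j i p))
  ... | tri≈ _ refl _ = refl
  ... | tri> _ _ p    = trans (graphOf-> b α i j p) (sym (graphOf-< b α j i p))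

  graphOf-unique : ∀ b (α : Coord n → Bool) (h : Graph n) →
    (∀ i j → h i j ≡ h j i) → (∀ i → h i i ≡ false) →
    (∀ i j p → α (b , i , j , p) ≡ h i j) → ∀ i j → graphOf b α i j ≡ h i j
  graphOf-unique b α h symm loopless agree i j with <-cmp i j
  ... | tri< p _ _    = trans (graphOf-< b α i j p) (agree i j p)
  ... | tri≈ _ refl _ = trans (graphOf-loopless b α i) (sym (loopless i))
  ... | tri> _ _ p    = trans (graphOf-> b α i j p) (trans (agree j i p) (symm j i))

  diffAt-≤ : ∀ (α β : Coord n → Bool) b i j {k} →
    (∀ p → ind (α (b , i , j , p) xor β (b , i , j , p)) ≤ k) → diffAt α β b i j ≤ k
  diffAt-≤ α β b i j bound with i <? j
  ... | yes p = bound p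
  ... | no _  = z≤n

  diffAt-agree : ∀ (α β : Coord n → Bool) b i j →
    (∀ p → α (b , i , j , p) xor β (b , i , j , p) ≡ false) → diffAt α β b i j ≡ 0
  diffAt-agree α β b i j agree with i <? j
  ... | yes p = cong ind (agree p)
  ... | no _  = refl

weaken : ∀ {I q} → DT I q → DT I (suc q)
weaken (leaf b)        = leaf b
weaken (query i t₀ t₁) = query i (weaken t₀) (weaken t₁)

run-weaken : ∀ {I q} (t : DT I q) α → run (weaken t) α ≡ run t α
run-weaken (leaf b)        α = refl
run-weaken (query i t₀ t₁) α with α i
... | true  = run-weaken t₁ α
... | false = run-weaken t₀ α

run-branch : ∀ {I q} (k : Bool → DT I q) α c → (if c then run (k true) α else run (k false) α) ≡ run (k c) α
run-branch k α true  = refl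
run-branch k α false = refl

module _ {n : ℕ} where

  -- Query the edge {x,y} of graph b and continue with the answer; a loop is
  -- known to be absent and costs no query.
  queryEdge : ∀ {q} → Bool → Fin n → Fin n → (Bool → DT (Coord n) q) → DT (Coord n) (suc q)
  queryEdge b x y k with x <? y | y <? x
  ... | yes p | _     = query (b , x , y , p) (k false) (k true)
  ... | no _  | yes p = query (b , y , x , p) (k false) (k true)
  ... | no _  | no _  = weaken (k false)

  run-queryEdge : ∀ {q} b x y (k : Bool → DT (Coord n) q) α →
    run (queryEdge b x y k) α ≡ run (k (graphOf b α x y)) α
  run-queryEdge b x y k α with x <? y | y <? x
  ... | yes p | _     = run-branch k α (α (b , x , y , p))
  ... | no _  | yes p = run-branch k α (α (b , y , x , p))
  ... | no _  | no _  = run-weaken (k false) α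

  Edge : Set
  Edge = Bool × Fin n × Fin n

  readEdge : (Coord n → Bool) → Edge → Bool
  readEdge α (b , x , y) = graphOf b α x y

  queryEdges : ∀ {k} → Vec Edge k → (Vec Bool k → Bool) → DT (Coord n) k
  queryEdges []                  decide = leaf (decide [])
  queryEdges ((b , x , y) ∷ es) decide = queryEdge b x y λ a → queryEdges es (decide ∘ (a ∷_))

  run-queryEdges : ∀ {k} (es : Vec Edge k) decide α →
    run (queryEdges es decide) α ≡ decide (Vec.map (readEdge α) es)
  run-queryEdges []                  decide α = refl
  run-queryEdges ((b , x , y) ∷ es) decide α =
    trans (run-queryEdge b x y _ α) (run-queryEdges es (decide ∘ (graphOf b α x y ∷_)) α)

  oddTriangle : (Coord n → Bool) → Fin n → Fin n → Fin n → Bool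
  oddTriangle α = triangleSum (Δ (graphOf false α) (graphOf true α))

  triangleEdges : Fin n → Fin n → Fin n → Vec Edge 6
  triangleEdges v u w =
    (false , v , u) ∷ (true , v , u) ∷ (false , v , w) ∷ (true , v , w) ∷ (false , u , w) ∷ (true , u , w) ∷ []

  acceptEven : Vec Bool 6 → Bool
  acceptEven (g₁ ∷ h₁ ∷ g₂ ∷ h₂ ∷ g₃ ∷ h₃ ∷ []) = not ((g₁ xor h₁) xor ((g₂ xor h₂) xor (g₃ xor h₃)))

  triangleTest : Fin n → Fin n → Fin n → DT (Coord n) 6
  triangleTest v u w = queryEdges (triangleEdges v u w) acceptEven

  run-triangleTest : ∀ α v u w → run (triangleTest v u w) α ≡ not (oddTriangle α v u w)
  run-triangleTest α v u w = run-queryEdges (triangleEdges v u w) acceptEven α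

module _ {X : Set} where

  sum-cong : ∀ (f g : X → ℕ) xs → (∀ x → f x ≡ g x) → sum (map f xs) ≡ sum (map g xs)
  sum-cong f g []       same = refl
  sum-cong f g (x ∷ xs) same = cong₂ _+_ (same x) (sum-cong f g xs same)

  sum-mono : ∀ (f g : X → ℕ) xs → (∀ x → f x ≤ g x) → sum (map f xs) ≤ sum (map g xs)
  sum-mono f g []       le = z≤n
  sum-mono f g (x ∷ xs) le = +-mono-≤ (le x) (sum-mono f g xs le)

  sum-zero : ∀ (f : X → ℕ) xs → (∀ x → f x ≡ 0) → sum (map f xs) ≡ 0
  sum-zero f []       vanish = refl
  sum-zero f (x ∷ xs) vanish = cong₂ _+_ (vanish x) (sum-zero f xs vanish)

  sum-const : ∀ c (xs : List X) → sum (map (λ _ → c) xs) ≡ length xs * c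
  sum-const c []       = refl
  sum-const c (x ∷ xs) = cong (c +_) (sum-const c xs)

  sum-concatMap : ∀ {Y : Set} (g : Y → ℕ) (h : X → List Y) xs →
    sum (map g (concatMap h xs)) ≡ sum (map (λ x → sum (map g (h x))) xs)
  sum-concatMap g h []       = refl
  sum-concatMap g h (x ∷ xs) = begin
    sum (map g (h x ++ concatMap h xs))           ≡⟨ cong sum (map-++ g (h x) _) ⟩
    sum (map g (h x) ++ map g (concatMap h xs))   ≡⟨ sum-++ (map g (h x)) _ ⟩
    sum (map g (h x)) + sum (map g (concatMap h xs))        ≡⟨ cong (_ +_) (sum-concatMap g h xs) ⟩
    sum (map (λ x → sum (map g (h x))) (x ∷ xs))            ∎
    where open ≡-Reasoning

  -- Some value is at most the average of f over xs (the default x serves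
  -- when xs is empty).
  below-average : ∀ (f : X → ℕ) (x : X) xs → ∃ λ y → length xs * f y ≤ sum (map f xs)
  below-average f x []       = x , z≤n
  below-average f x (y ∷ ys) with below-average f y ys
  ... | z , z≤average with f y ≤? f z
  ...   | yes y≤z = y , +-monoʳ-≤ (f y) (≤-trans (*-monoʳ-≤ (length ys) y≤z) z≤average)
  ...   | no y≰z  = z , +-mono-≤ (<⇒≤ (≰⇒> y≰z)) z≤average

length-filter-false : ∀ {X Y : Set} (p : Y → Bool) (f : X → Y) xs →
  length (filter (λ y → p y ≟B false) (map f xs)) ≡ sum (map (λ x → ind (not (p (f x)))) xs)
length-filter-false p f []       = refl
length-filter-false p f (x ∷ xs) with p (f x)
... | true  = length-filter-false p f xs
... | false = cong suc (length-filter-false p f xs)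

length-allFin : ∀ n → length (allFin n) ≡ n
length-allFin n = length-tabulate {n = n} (λ i → i)

sum-allFin-const : ∀ n c → sum (map (λ _ → c) (allFin n)) ≡ n * c
sum-allFin-const n c = trans (sum-const c (allFin n)) (cong (_* c) (length-allFin n))

Triple : ℕ → Set
Triple n = Fin n × Fin n × Fin n

triples : ∀ n → List (Triple n)
triples n = concatMap (λ v → concatMap (λ u → map (λ w → (v , u , w)) (allFin n)) (allFin n)) (allFin n)

sum-triples : ∀ n (g : Triple n → ℕ) →
  sum (map g (triples n)) ≡ sum (map (λ v → sum (map (λ u → sum (map (λ w → g (v , u , w)) (allFin n))) (allFin n))) (allFin n))
sum-triples n g =
  trans (sum-concatMap g _ (allFin n)) (sum-cong _ _ (allFin n) λ v →
  trans (sum-concatMap g _ (allFin n)) (sum-cong _ _ (allFin n) λ u →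
  cong sum (sym (map-∘ (allFin n)))))

length-triples : ∀ n → length (triples n) ≡ n * (n * n)
length-triples n = begin
  length (triples n)                                    ≡⟨ sym (trans (sum-const 1 (triples n)) (*-identityʳ _)) ⟩
  sum (map (λ _ → 1) (triples n))                       ≡⟨ sum-triples n (λ _ → 1) ⟩
  sum (map (λ _ → sum (map (λ _ → sum (map (λ _ → 1) (allFin n))) (allFin n))) (allFin n))
    ≡⟨ sum-cong _ _ (allFin n) (λ _ → trans (sum-cong _ _ (allFin n) λ _ →
                                 trans (sum-allFin-const n 1) (*-identityʳ n)) (sum-allFin-const n n)) ⟩
  sum (map (λ _ → n * n) (allFin n))                    ≡⟨ sum-allFin-const n (n * n) ⟩
  n * (n * n)                                           ∎
  where open ≡-Reasoning

triangleTestAt : ∀ {n} → Triple n → DT (Coord n) 6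
triangleTestAt (v , u , w) = triangleTest v u w

oddTriangleAt : ∀ {n} → (Coord n → Bool) → Triple n → Bool
oddTriangleAt α (v , u , w) = oddTriangle α v u w

-- Run the triangle test on a uniformly random ordered triple; one extra
-- accepting coin keeps the list nonempty when n = 0.
tester : ∀ n → RandAlg (Coord n) 6
tester n = record { trees = leaf true ∷ map triangleTestAt (triples n) ; nonempty = λ () }

length-tester : ∀ n → length (RandAlg.trees (tester n)) ≡ suc (n * (n * n))
length-tester n = cong suc (trans (length-map triangleTestAt (triples n)) (length-triples n))

rejects-tester : ∀ {n} (α : Coord n → Bool) →
  rejects (tester n) α ≡ sum (map (λ t → ind (oddTriangleAt α t)) (triples n))
rejects-tester {n} α =
  trans (length-filter-false (λ t → run t α) triangleTestAt (triples n))
        (sum-cong _ _ (triples n) λ where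
          (v , u , w) → cong ind (trans (cong not (run-triangleTest α v u w)) (not-involutive _)))

oddAt : ∀ {n} → (Coord n → Bool) → Fin n → ℕ
oddAt {n} α v = sum (map (λ u → sum (map (λ w → ind (oddTriangle α v u w)) (allFin n))) (allFin n))

rejects-by-vertex : ∀ {n} (α : Coord n → Bool) → rejects (tester n) α ≡ sum (map (oddAt α) (allFin n))
rejects-by-vertex {n} α = trans (rejects-tester α) (sum-triples n (λ t → ind (oddTriangleAt α t)))

tester-complete : ∀ n α → SeidelPairs n α → rejects (tester n) α ≡ 0
tester-complete n α equiv = trans (rejects-tester α) (sum-zero _ (triples n) λ where
  (v , u , w) → cong ind (seidel-triangle equiv v u w))

module Repair {n : ℕ} (α : Coord n → Bool) (v : Fin n) where
  open xor-∧-Solver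

  Γ Γ′ : Graph n
  Γ  = graphOf false α
  Γ′ = graphOf true α

  disagree : Fin n → Bool
  disagree = Δ Γ Γ′ v

  -- Γ switched along the disagreement set: Seidel equivalent to Γ, and it
  -- agrees with Γ′ on all pairs containing v.
  repaired : Graph n
  repaired = switchSet disagree Γ

  β : Coord n → Bool
  β (false , e)         = α (false , e)
  β (true , i , j , _)  = repaired i j

  repaired-sym : ∀ i j → repaired i j ≡ repaired j i
  repaired-sym i j = cong₂ _xor_ (xor-comm (disagree i) (disagree j)) (graphOf-sym false α i j)

  repaired-loopless : ∀ i → repaired i i ≡ false
  repaired-loopless i = cong₂ _xor_ (xor-same (disagree i)) (graphOf-loopless false α i)

  β-first : ∀ i j → graphOf false β i j ≡ Γ i j
  β-first = graphOf-unique false β Γ (graphOf-sym false α) (graphOf-loopless false α)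
              (λ i j p → sym (graphOf-< false α i j p))

  β-second : ∀ i j → graphOf true β i j ≡ repaired i j
  β-second = graphOf-unique true β repaired repaired-sym repaired-loopless (λ i j p → refl)

  β-seidel : SeidelPairs n β
  β-seidel = switchSet-equiv disagree (graphOf false β) (graphOf true β) λ i j →
    trans (cong ((disagree i xor disagree j) xor_) (β-first i j)) (sym (β-second i j))

  repair-defect : ∀ i j (p : i <F j) → α (true , i , j , p) xor repaired i j ≡ oddTriangle α v i j
  repair-defect i j p = trans (cong (_xor repaired i j) (sym (graphOf-< true α i j p)))
    (solve 4 (λ a b x y → y :+ ((a :+ b) :+ x) := a :+ (b :+ (x :+ y))) refl
      (disagree i) (disagree j) (Γ i j) (Γ′ i j))

  diff-first : ∀ i j → diffAt α β false i j ≡ 0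
  diff-first i j = diffAt-agree α β false i j λ p → xor-same (α (false , i , j , p))

  diff-second : ∀ i j → diffAt α β true i j ≤ ind (oddTriangle α v i j)
  diff-second i j = diffAt-≤ α β true i j λ p → ≤-reflexive (cong ind (repair-defect i j p))

  hamming-repair : hamming α β ≤ oddAt α v
  hamming-repair = begin
    hamming α β                  ≤⟨ +-mono-≤ (≤-reflexive first-unchanged) (+-monoˡ-≤ 0 second-bounded) ⟩
    0 + (oddAt α v + 0)          ≡⟨ +-identityʳ (oddAt α v) ⟩
    oddAt α v                    ∎
    where
    open ≤-Reasoning
    first-unchanged : sum (map (λ i → sum (map (diffAt α β false i) (allFin n))) (allFin n)) ≡ 0
    first-unchanged = sum-zero _ (allFin n) λ i → sum-zero _ (allFin n) (diff-first i)
    second-bounded : sum (map (λ i → sum (map (diffAt α β true i) (allFin n))) (allFin n)) ≤ oddAt α v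
    second-bounded = sum-mono _ _ (allFin n) λ i → sum-mono _ _ (allFin n) (diff-second i)

module _ where
  open +-*-Solver

  twice-choose2 : ∀ n → 2 * (n C 2) + n ≡ n * n
  twice-choose2 zero    = refl
  twice-choose2 (suc n) = begin
    2 * (suc n C 2) + suc n     ≡⟨ cong (λ c → 2 * c + suc n) (sym (nCk+nC[k+1]≡[n+1]C[k+1] n 1)) ⟩
    2 * (n C 1 + n C 2) + suc n ≡⟨ cong (λ c → 2 * (c + n C 2) + suc n) (nC1≡n n) ⟩
    2 * (n + n C 2) + suc n     ≡⟨ solve 2 (λ a c → con 2 :* (a :+ c) :+ (con 1 :+ a)
                                                   := (con 2 :* c :+ a) :+ a :+ a :+ con 1) refl n (n C 2) ⟩
    2 * (n C 2) + n + n + n + 1 ≡⟨ cong (λ m → m + n + n + 1) (twice-choose2 n) ⟩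
    n * n + n + n + 1           ≡⟨ solve 1 (λ a → a :* a :+ a :+ a :+ con 1 := (con 1 :+ a) :* (con 1 :+ a)) refl n ⟩
    suc n * suc n               ∎
    where open ≡-Reasoning

  square≤thrice-pairs : ∀ n → 2 ≤ n → 1 + n * n ≤ 3 * (2 * (n C 2))
  square≤thrice-pairs n 2≤n = begin
    1 + n * n       ≡⟨ cong (1 +_) (sym (twice-choose2 n)) ⟩
    1 + (K + n)     ≡⟨ solve 2 (λ k m → con 1 :+ (k :+ m) := k :+ (con 1 :+ m)) refl K n ⟩
    K + (1 + n)     ≤⟨ +-monoʳ-≤ K (+-mono-≤ (≤-trans (≤-trans (s≤s z≤n) 2≤n) n≤K) n≤K) ⟩
    K + (K + K)     ≡⟨ solve 1 (λ k → k :+ (k :+ k) := con 3 :* k) refl K ⟩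
    3 * K           ∎
    where
    open ≤-Reasoning
    K = 2 * (n C 2)
    n≤K : n ≤ K
    n≤K = +-cancelʳ-≤ n n K (begin
      n + n     ≡⟨ solve 1 (λ m → m :+ m := con 2 :* m) refl n ⟩
      2 * n     ≤⟨ *-monoˡ-≤ n 2≤n ⟩
      n * n     ≡⟨ sym (twice-choose2 n) ⟩
      K + n     ∎)

  -- Soundness in numbers: if the distance d is at most r (repair at the
  -- best vertex) and n·r ≤ R (averaging), then d·(1 + n³) ≤ R · 3 · 2C(n,2).
  soundness-arithmetic : ∀ n {d r R} → 2 ≤ n →
    d ≤ r → n * r ≤ R → 1 * d * suc (n * (n * n)) ≤ R * 3 * (2 * (n C 2))
  soundness-arithmetic n {d} {r} {R} 2≤n@(s≤s (s≤s _)) d≤r nr≤R = begin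
    1 * d * suc (n * (n * n))   ≤⟨ *-monoˡ-≤ (suc (n * (n * n))) (≤-trans (≤-reflexive (*-identityˡ d)) d≤r) ⟩
    r * suc (n * (n * n))       ≡⟨ solve 2 (λ x y → x :* (con 1 :+ y :* (y :* y)) := x :+ (y :* x) :* (y :* y)) refl r n ⟩
    r + (n * r) * (n * n)       ≤⟨ +-mono-≤ (≤-trans (m≤n*m r n) nr≤R) (*-monoˡ-≤ (n * n) nr≤R) ⟩
    R + R * (n * n)             ≡⟨ solve 2 (λ x y → x :+ x :* (y :* y) := x :* (con 1 :+ y :* y)) refl R n ⟩
    R * (1 + n * n)             ≤⟨ *-monoʳ-≤ R (square≤thrice-pairs n 2≤n) ⟩
    R * (3 * (2 * (n C 2)))     ≡⟨ sym (*-assoc R 3 _) ⟩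
    R * 3 * (2 * (n C 2))       ∎
    where open ≤-Reasoning

-- Every word is within distance (#rejections)/(3·#coins) of a Seidel pair:
-- for n ≥ 2 repair at a vertex with at most the average number of odd
-- triangles.
tester-sound-large : ∀ n → 2 ≤ n → ∀ α → ∃ λ β → SeidelPairs n β ×
  (1 * hamming α β * length (RandAlg.trees (tester n)) ≤ rejects (tester n) α * 3 * (2 * (n C 2)))
tester-sound-large n 2≤n α with below-average (oddAt α) (fromℕ< (≤-trans (s≤s z≤n) 2≤n)) (allFin n)
... | v , v≤average = Repair.β α v , Repair.β-seidel α v , (begin
  1 * hamming α β * length (RandAlg.trees (tester n))
    ≡⟨ cong (1 * hamming α β *_) (length-tester n) ⟩
  1 * hamming α β * suc (n * (n * n))
    ≤⟨ soundness-arithmetic n 2≤n (Repair.hamming-repair α v)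
         (≤-trans (≤-reflexive (cong (_* oddAt α v) (sym (length-allFin n)))) v≤average) ⟩
  sum (map (oddAt α) (allFin n)) * 3 * (2 * (n C 2))
    ≡⟨ cong (λ R → R * 3 * (2 * (n C 2))) (sym (rejects-by-vertex α)) ⟩
  rejects (tester n) α * 3 * (2 * (n C 2)) ∎)
  where
  open ≤-Reasoning
  β : Coord n → Bool
  β = Repair.β α v

-- For n ≤ 1 there are no pairs, so any Seidel pair is at distance 0.
tester-sound : ∀ n α → ∃ λ β → SeidelPairs n β ×
  (1 * hamming α β * length (RandAlg.trees (tester n)) ≤ rejects (tester n) α * 3 * (2 * (n C 2)))
tester-sound zero          α = α , done (λ ()) , z≤n
tester-sound (suc zero)    α = Repair.β α zero , Repair.β-seidel α zero , z≤n
tester-sound (suc (suc m)) α = tester-sound-large (suc (suc m)) (s≤s (s≤s z≤n)) α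

proposition18 : ∃ λ q → ∃ λ a → ∃ λ b → a > 0 × b > 0 ×
    (∀ n → Testable (Coord n) (2 * (n C 2)) hamming (SeidelPairs n) q a b)
proposition18 = 6 , 1 , 3 , s≤s z≤n , s≤s z≤n , λ n → tester n , tester-complete n , tester-sound n
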